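{- Let $E\subseteq\mathbb{Z}$ and suppose $\chi_E=f_a+f_b$, where $f_a,f_b:\mathbb{Z}\to\mathbb{C}$ are periodic with coprime periods $a$ and $b$ respectively. Then $\chi_E$ is periodic with period $a$ or with period $b$.
   Context: $\chi_E$ denotes the indicator function of $E$. -}

module Defs where

open import Level using (Level)
open import Data.Bool using (Bool; true; false)
open import Data.Nat using (ℕ; suc)
open import Data.Integer using (ℤ; +_) renaming (_+_ to _+ℤ_)
open import Relation.Nullary using (¬_)
open import Algebra.Bundles using (CommutativeRing)

module _ {c ℓ : Level} (R : CommutativeRing c ℓ) where
  open CommutativeRing R

  natR : ℕ → Carrier
  natR 0 = 0#
  natR (suc n) = 1# + natR n

  -- R has characteristic zero (as ℂ does)
  CharZero : Set ℓ
  CharZero = ∀ (n : ℕ) → ¬ (natR (suc n) ≈ 0#)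

  χ : (ℤ → Bool) → ℤ → Carrier
  χ E x with E x
  ... | true  = 1#
  ... | false = 0#

  Periodic : ℕ → (ℤ → Carrier) → Set ℓ
  Periodic p f = ∀ (x : ℤ) → f (x +ℤ + p) ≈ f x

{-# OPTIONS --safe #-}
-- Since fa and fb are killed by the difference operators along a and b respectively,
-- χ has vanishing mixed second difference: χ w + χ (w+a+b) = χ (w+a) + χ (w+b).
-- For 0/1 values in characteristic zero this forces each square w, w+a, w+b, w+a+b
-- to be constant along a or along b. Hence "E (w+b) = E w" propagates along a,
-- "E (w+a) = E w" propagates along b, and at every w one of the two holds. If the
-- first fails at some y, it fails on y + aℤ, so the second holds on y + aℤ + bℤ = ℤ
-- (Bézout). Testing the first on the residues modulo a decides which case occurs.
module Submission where

open import Defs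
open import Data.Bool using (Bool; true; false)
import Data.Bool as Bool
open import Data.Nat using (ℕ; _≥_)
open import Data.Nat.Coprimality using (Coprime)
open import Data.Integer using (ℤ)
open import Data.Sum using (_⊎_)
open import Algebra.Bundles using (CommutativeRing)

open import Level using (Level)
open import Function using (_∘_; id)
open import Function.Bundles using (_⇔_; mk⇔; Equivalence)
open import Function.Construct.Identity using (⇔-id)
open import Function.Construct.Composition using (_⇔-∘_)
open import Function.Related.TypeIsomorphisms using (¬-cong-⇔)
open import Data.Nat as ℕ using (zero; suc; NonZero; >-nonZero)
open import Data.Nat.Properties using (allUpTo?)
open import Data.Nat.GCD using (module Bézout)
import Data.Nat.Coprimality as Coprimality
open import Data.Integer using (+_; -[1+_]; _+_; _-_; _*_; -_; 0ℤ; 1ℤ)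
import Data.Integer.Properties as ℤ
open import Data.Integer.DivMod using (_%ℕ_; _/ℕ_; a≡a%ℕn+[a/ℕn]*n; n%ℕd<d)
open import Data.Integer.Tactic.RingSolver using (solve-∀)
open import Algebra.Properties.CommutativeSemigroup ℤ.+-commutativeSemigroup
  using () renaming (xy∙z≈xz∙y to +-rightComm)
open import Data.Product using (_×_; _,_; ∃₂; map₂)
open import Data.Sum using (inj₁; inj₂; swap) renaming (map to map⊎)
open import Relation.Nullary using (¬_; yes; no; contradiction)
open import Relation.Nullary.Decidable using (decidable-stable)
open import Relation.Binary.Definitions using (DecidableEquality)
open import Relation.Binary.PropositionalEquality
  using (_≡_; refl; sym; trans; cong; subst; module ≡-Reasoning)
import Relation.Binary.Reasoning.Setoid as SetoidReasoning
import Algebra.Properties.Group as GroupProperties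
import Algebra.Properties.CommutativeSemigroup as CommutativeSemigroupProperties

open Equivalence using (to; from)

pos-suc-* : ∀ m n i j → suc (m ℕ.* n) ≡ i ℕ.* j → 1ℤ + + m * + n ≡ + i * + j
pos-suc-* m n i j eq =
  trans (cong (λ u → 1ℤ + u) (sym (ℤ.pos-* m n))) (trans (cong +_ eq) (ℤ.pos-* i j))

ℤ-bézout : ∀ {p q} → Coprime p q → ∃₂ λ s t → s * + p + t * + q ≡ 1ℤ
ℤ-bézout {p} {q} cop with Coprimality.coprime-Bézout cop
... | Bézout.+- x y eq = + x , - + y , (begin
  + x * + p + - + y * + q        ≡⟨ cong (_+ - + y * + q) (pos-suc-* y q x p eq) ⟨
  1ℤ + + y * + q + - + y * + q   ≡⟨ cancel (+ y) (+ q) ⟩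
  1ℤ                             ∎)
  where open ≡-Reasoning
        cancel : ∀ u v → 1ℤ + u * v + - u * v ≡ 1ℤ
        cancel = solve-∀
... | Bézout.-+ x y eq = - + x , + y , (begin
  - + x * + p + + y * + q          ≡⟨ cong (λ u → - + x * + p + u) (pos-suc-* x p y q eq) ⟨
  - + x * + p + (1ℤ + + x * + p)   ≡⟨ cancel (+ x) (+ p) ⟩
  1ℤ                               ∎)
  where open ≡-Reasoning
        cancel : ∀ u v → - u * v + (1ℤ + u * v) ≡ 1ℤ
        cancel = solve-∀

bézout-reach : ∀ {p q} → Coprime p q → ∀ y z → ∃₂ λ k l → y + k * + p + l * + q ≡ z
bézout-reach {p} {q} cop y z with ℤ-bézout cop
... | s , t , combination≡1 = (z - y) * s , (z - y) * t , (begin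
  y + (z - y) * s * + p + (z - y) * t * + q   ≡⟨ distrib y (z - y) s t (+ p) (+ q) ⟩
  y + (z - y) * (s * + p + t * + q)           ≡⟨ cong (λ u → y + (z - y) * u) combination≡1 ⟩
  y + (z - y) * 1ℤ                            ≡⟨ cancel y z ⟩
  z                                           ∎)
  where open ≡-Reasoning
        distrib : ∀ y d s t u v → y + d * s * u + d * t * v ≡ y + d * (s * u + t * v)
        distrib = solve-∀
        cancel : ∀ y z → y + (z - y) * 1ℤ ≡ z
        cancel = solve-∀

Invariant : ℤ → (ℤ → Set) → Set
Invariant c P = ∀ w → P w ⇔ P (w + c)

module _ {c : ℤ} {P : ℤ → Set} (inv : Invariant c P) where

  invariant-+multiple : ∀ n w → P w ⇔ P (w + + n * c)
  invariant-+multiple zero    w = subst (λ v → P w ⇔ P v) (plus-zero w c) (⇔-id _)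
    where plus-zero : ∀ w c → w ≡ w + 0ℤ * c
          plus-zero = solve-∀
  invariant-+multiple (suc n) w =
    subst (λ v → P w ⇔ P v) (plus-one w (+ n) c) (inv _ ⇔-∘ invariant-+multiple n w)
    where plus-one : ∀ w m c → w + m * c + c ≡ w + (1ℤ + m) * c
          plus-one = solve-∀

  invariant-multiple : ∀ k {w} → P w → P (w + k * c)
  invariant-multiple (+ n)    {w} = to (invariant-+multiple n w)
  invariant-multiple -[1+ n ] {w} Pw =
    from (invariant-+multiple (suc n) _) (subst P (sym (back w (+ suc n) c)) Pw)
    where back : ∀ w m c → w + - m * c + m * c ≡ w
          back = solve-∀

module _ {A : Set} (E : ℤ → A) where

  PeriodicAt : ℕ → ℤ → Set
  PeriodicAt p w = E (w + + p) ≡ E w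

  SquareSplits : ℕ → ℕ → ℤ → Set
  SquareSplits p q w = PeriodicAt p w × PeriodicAt p (w + + q)
                     ⊎ PeriodicAt q w × PeriodicAt q (w + + p)

  module _ {p q : ℕ} {w : ℤ} where

    splits-sym : SquareSplits p q w → SquareSplits q p w
    splits-sym = swap

    splits⇒periodicAt-invariant : SquareSplits p q w →
                                  PeriodicAt q w ⇔ PeriodicAt q (w + + p)
    splits⇒periodicAt-invariant (inj₂ (here , there)) = mk⇔ (λ _ → there) (λ _ → here)
    splits⇒periodicAt-invariant (inj₁ (here , there)) = mk⇔ forward backward
      where
        open ≡-Reasoning
        corner : E (w + + p + + q) ≡ E (w + + q)
        corner = trans (cong E (+-rightComm w (+ p) (+ q))) there
        forward : PeriodicAt q w → PeriodicAt q (w + + p)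
        forward periodic = begin
          E (w + + p + + q)  ≡⟨ corner ⟩
          E (w + + q)        ≡⟨ periodic ⟩
          E w                ≡⟨ here ⟨
          E (w + + p)        ∎
        backward : PeriodicAt q (w + + p) → PeriodicAt q w
        backward periodic = begin
          E (w + + q)        ≡⟨ corner ⟨
          E (w + + p + + q)  ≡⟨ periodic ⟩
          E (w + + p)        ≡⟨ here ⟩
          E w                ∎

    splits⇒periodicAt : SquareSplits p q w → ¬ PeriodicAt q w → PeriodicAt p w
    splits⇒periodicAt (inj₁ (here , _)) _          = here
    splits⇒periodicAt (inj₂ (here , _)) ¬periodic = contradiction here ¬periodic

  module _ {p q : ℕ} (splits : ∀ w → SquareSplits p q w) where

    periodicAt-invariant : Invariant (+ p) (PeriodicAt q)
    periodicAt-invariant w = splits⇒periodicAt-invariant (splits w)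

    aperiodicAt-invariant : Invariant (+ p) (λ w → ¬ PeriodicAt q w)
    aperiodicAt-invariant w = ¬-cong-⇔ (periodicAt-invariant w)

  aperiodicAt⇒periodic : ∀ {p q} → (∀ w → SquareSplits p q w) → Coprime p q →
                         ∀ {y} → ¬ PeriodicAt q y → ∀ z → PeriodicAt p z
  aperiodicAt⇒periodic {p} {q} splits cop {y} ¬periodic z =
    let k , l , reach = bézout-reach cop y z in
    subst (PeriodicAt p) reach
      (invariant-multiple (periodicAt-invariant (splits-sym ∘ splits)) l
        (splits⇒periodicAt (splits (y + k * + p))
          (invariant-multiple (aperiodicAt-invariant splits) k ¬periodic)))

  splits⇒periodic : DecidableEquality A → ∀ {p q} .{{_ : NonZero p}} →
                    (∀ w → SquareSplits p q w) → Coprime p q →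
                    (∀ x → PeriodicAt p x) ⊎ (∀ x → PeriodicAt q x)
  splits⇒periodic _≟_ {p} {q} splits cop with allUpTo? (λ n → E (+ n + + q) ≟ E (+ n)) p
  ... | yes residues = inj₂ λ x → subst (PeriodicAt q) (sym (a≡a%ℕn+[a/ℕn]*n x p))
    (invariant-multiple (periodicAt-invariant splits) (x /ℕ p) (residues (n%ℕd<d x p)))
  ... | no ¬residues = inj₁ λ x → decidable-stable (E (x + + p) ≟ E x) λ ¬periodic →
    ¬residues λ {n} _ →
      aperiodicAt⇒periodic (splits-sym ∘ splits) (Coprimality.sym cop) ¬periodic (+ n)

toℕ : Bool → ℕ
toℕ false = 0
toℕ true  = 1

bit-square-splits : ∀ p q r s → toℕ p ℕ.+ toℕ s ≡ toℕ q ℕ.+ toℕ r →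
                    q ≡ p × s ≡ r ⊎ r ≡ p × s ≡ q
bit-square-splits false false false false _ = inj₁ (refl , refl)
bit-square-splits false false false true  ()
bit-square-splits false false true  false ()
bit-square-splits false false true  true  _ = inj₁ (refl , refl)
bit-square-splits false true  false false ()
bit-square-splits false true  false true  _ = inj₂ (refl , refl)
bit-square-splits false true  true  false ()
bit-square-splits false true  true  true  ()
bit-square-splits true  false false false ()
bit-square-splits true  false false true  ()
bit-square-splits true  false true  false _ = inj₂ (refl , refl)
bit-square-splits true  false true  true  ()
bit-square-splits true  true  false false _ = inj₁ (refl , refl)
bit-square-splits true  true  false true  ()
bit-square-splits true  true  true  false ()
bit-square-splits true  true  true  true  _ = inj₁ (refl , refl)

module _ {c ℓ : Level} (R : CommutativeRing c ℓ) where

  open CommutativeRing R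
    using (Carrier; _≈_; 1#; setoid; +-cong; +-congˡ; +-congʳ; +-comm; +-assoc;
           +-identityˡ; +-identityʳ; +-group; +-commutativeSemigroup; reflexive)
    renaming (_+_ to _⊕_; refl to ≈-refl; sym to ≈-sym; trans to ≈-trans)
  open GroupProperties +-group using (∙-cancelˡ)
  open CommutativeSemigroupProperties +-commutativeSemigroup using (interchange)
  open SetoidReasoning setoid

  natR-+ : ∀ m n → natR R (m ℕ.+ n) ≈ natR R m ⊕ natR R n
  natR-+ zero    n = ≈-sym (+-identityˡ _)
  natR-+ (suc m) n = ≈-trans (+-congˡ (natR-+ m n)) (≈-sym (+-assoc 1# _ _))

  natR-injective : CharZero R → ∀ {m n} → natR R m ≈ natR R n → m ≡ n
  natR-injective _    {zero}  {zero}  _ = refl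
  natR-injective char {zero}  {suc n} e = contradiction (≈-sym e) (char n)
  natR-injective char {suc m} {zero}  e = contradiction e (char m)
  natR-injective char {suc m} {suc n} e = cong suc (natR-injective char (∙-cancelˡ 1# _ _ e))

  χ≈natR : ∀ E x → χ R E x ≈ natR R (toℕ (E x))
  χ≈natR E x with E x
  ... | true  = ≈-sym (+-identityʳ 1#)
  ... | false = ≈-refl

  χ-+ : ∀ E x y → χ R E x ⊕ χ R E y ≈ natR R (toℕ (E x) ℕ.+ toℕ (E y))
  χ-+ E x y = ≈-trans (+-cong (χ≈natR E x) (χ≈natR E y)) (≈-sym (natR-+ (toℕ (E x)) (toℕ (E y))))

  χ-periodic : ∀ {E p} → (∀ x → PeriodicAt E p x) → Periodic R p (χ R E)
  χ-periodic {E} {p} periodic x = begin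
    χ R E (x + + p)           ≈⟨ χ≈natR E _ ⟩
    natR R (toℕ (E (x + + p))) ≡⟨ cong (natR R ∘ toℕ) (periodic x) ⟩
    natR R (toℕ (E x))        ≈⟨ χ≈natR E x ⟨
    χ R E x                   ∎

  second-difference : ∀ {a b} {fa fb g : ℤ → Carrier} → Periodic R a fa → Periodic R b fb →
                      (∀ x → g x ≈ fa x ⊕ fb x) →
                      ∀ w → g w ⊕ g (w + + a + + b) ≈ g (w + + a) ⊕ g (w + + b)
  second-difference {a} {b} {fa} {fb} {g} pa pb g≈ w = begin
    g w ⊕ g (w + + a + + b)
      ≈⟨ +-cong (g≈ w) (≈-trans (g≈ _) (+-cong fa-corner (pb (w + + a)))) ⟩
    (fa w ⊕ fb w) ⊕ (fa (w + + b) ⊕ fb (w + + a))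
      ≈⟨ interchange _ _ _ _ ⟩
    (fa w ⊕ fa (w + + b)) ⊕ (fb w ⊕ fb (w + + a))
      ≈⟨ +-congˡ (+-comm _ _) ⟩
    (fa w ⊕ fa (w + + b)) ⊕ (fb (w + + a) ⊕ fb w)
      ≈⟨ interchange _ _ _ _ ⟩
    (fa w ⊕ fb (w + + a)) ⊕ (fa (w + + b) ⊕ fb w)
      ≈⟨ +-cong (+-congʳ (pa w)) (+-congˡ (pb w)) ⟨
    (fa (w + + a) ⊕ fb (w + + a)) ⊕ (fa (w + + b) ⊕ fb (w + + b))
      ≈⟨ +-cong (g≈ _) (g≈ _) ⟨
    g (w + + a) ⊕ g (w + + b)
      ∎
    where fa-corner : fa (w + + a + + b) ≈ fa (w + + b)
          fa-corner = ≈-trans (reflexive (cong fa (+-rightComm w (+ a) (+ b)))) (pa _)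

  χ-splits : CharZero R → ∀ {E a b fa fb} → Periodic R a fa → Periodic R b fb →
             (∀ x → χ R E x ≈ fa x ⊕ fb x) → ∀ w → SquareSplits E a b w
  χ-splits char {E} {a} {b} pa pb χ≈ w =
    map⊎ (map₂ (trans (cong E (+-rightComm w (+ b) (+ a))))) id
      (bit-square-splits _ _ _ _ (natR-injective char (begin
        natR R (toℕ (E w) ℕ.+ toℕ (E (w + + a + + b)))  ≈⟨ χ-+ E _ _ ⟨
        χ R E w ⊕ χ R E (w + + a + + b)                  ≈⟨ second-difference pa pb χ≈ w ⟩
        χ R E (w + + a) ⊕ χ R E (w + + b)                ≈⟨ χ-+ E _ _ ⟩
        natR R (toℕ (E (w + + a)) ℕ.+ toℕ (E (w + + b))) ∎)))

lemma3 : ∀ {c ℓ} (R : CommutativeRing c ℓ) → CharZero R →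
         (E : ℤ → Bool) (a b : ℕ) → a ≥ 1 → b ≥ 1 → Coprime a b →
         (fa fb : ℤ → CommutativeRing.Carrier R) →
         Periodic R a fa → Periodic R b fb →
         (∀ (x : ℤ) → CommutativeRing._≈_ R (χ R E x) (CommutativeRing._+_ R (fa x) (fb x))) →
         Periodic R a (χ R E) ⊎ Periodic R b (χ R E)
lemma3 R char E a b a≥1 _ cop fa fb pa pb χ≈ =
  map⊎ (χ-periodic R) (χ-periodic R)
    (splits⇒periodic E Bool._≟_ {{>-nonZero a≥1}} (χ-splits R char pa pb χ≈) cop)
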